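{- Every regular $\mathscr{D}$-class of the endomorphism monoid of the countable universal directed graph $D$ contains $2^{\aleph_0}$ many $\mathscr{L}$-classes and $2^{\aleph_0}$ many $\mathscr{R}$-classes.
   Context: A directed graph is a pair $(V,E)$ with $E$ an irreflexive binary relation on $V$. The countable universal directed graph $D$ is the Fraïssé limit of the finite directed graphs; $\operatorname{End} D$ is its endomorphism monoid. Green's relations on a monoid $M$: $f\,\mathscr{L}\,g$ iff $Mf=Mg$; $f\,\mathscr{R}\,g$ iff $fM=gM$; $\mathscr{D}=\mathscr{L}\circ\mathscr{R}$. An element $f$ is regular if $fgf=f$ for some $g\in M$; a regular $\mathscr{D}$-class consists of regular elements. -}

module Defs where

open import Data.Nat using (ℕ)
open import Data.Bool using (Bool; T)
open import Data.Product using (Σ; ∃; ∃-syntax; _×_; _,_; proj₁; proj₂)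
open import Data.List using (List)
open import Data.List.Membership.Propositional using (_∈_; _∉_)
open import Relation.Nullary using (¬_; Dec)
open import Relation.Binary.PropositionalEquality using (_≡_)
open import Function.Bundles using (_⇔_)

-- A directed graph on vertex set ℕ (countable) with irreflexive edge relation E
-- (decidable, as for the standard construction of D) satisfying the
-- one-point extension property of the Fraïssé limit of finite digraphs:
-- for every finite set A of vertices and every prescription t of
-- (edge v→a ?, edge a→v ?) for a ∈ A, there is a new vertex v realising it.
-- Such a graph is, up to isomorphism, the countable universal digraph D.
record UniversalDigraph : Set₁ where
  field
    E         : ℕ → ℕ → Set
    E?        : ∀ x y → Dec (E x y)
    irrefl    : ∀ x → ¬ E x x
    extension : (A : List ℕ) (t : ℕ → Bool × Bool) →
                ∃[ v ] (v ∉ A × (∀ a → a ∈ A →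
                   (E v a ⇔ T (proj₁ (t a))) × (E a v ⇔ T (proj₂ (t a)))))

module EndMonoid (G : UniversalDigraph) where
  open UniversalDigraph G

  record End : Set where
    constructor endo
    field
      fun : ℕ → ℕ
      hom : ∀ {x y} → E x y → E (fun x) (fun y)
  open End public

  _≈_ : End → End → Set
  f ≈ g = ∀ x → fun f x ≡ fun g x

  _·_ : End → End → End
  f · g = endo (λ x → fun f (fun g x)) (λ e → hom f (hom g e))

  _L_ : End → End → Set
  f L g = (∃[ h ] ((h · f) ≈ g)) × (∃[ k ] ((k · g) ≈ f))

  _R_ : End → End → Set
  f R g = (∃[ h ] ((f · h) ≈ g)) × (∃[ k ] ((g · k) ≈ f))

  _D_ : End → End → Set
  f D g = ∃[ h ] ((f L h) × (h R g))

  Regular : End → Set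
  Regular f = ∃[ g ] (((f · g) · f) ≈ f)

-- Inside D build a copy of a graph Γ with a "tree" vertex for each node of the
-- infinite binary tree, adjacent as their depths are adjacent in D, and isolated
-- "switch" vertices s₀, s₁, …, placed so that a vertex outside the copy is
-- adjacent only to copy vertices whose index does not exceed it.  Then for every a : ℕ → Bool
-- the map "node ↦ its depth, sₙ ↦ 0 or a neighbour of 0 according to a n"
-- extends to an endomorphism V a, and following the branch c through the tree
-- is an embedding Z c with V a ∘ Z c = id.  Hence f ∘ V a R f and Z a ∘ f L f.
-- If f ∘ V a L f ∘ V b but a n ≠ b n, then one of V a, V b identifies the root
-- with sₙ and the other sends them to adjacent vertices, which f would have to
-- identify.  If Z a ∘ f R Z b ∘ f, then Z a and Z b agree on the image of f,
-- which is unbounded when f is regular, so a and b agree on arbitrarily long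
-- prefixes.
module Submission where

open import Defs
open import Data.Bool using (Bool; true; false; T)
open import Data.Empty using (⊥-elim)
open import Data.List using (List; []; _∷_; _++_; map; upTo)
open import Data.List.Membership.Propositional using (_∈_; _∉_)
open import Data.List.Membership.Propositional.Properties using (∈-upTo⁺; ∈-map⁺; ∈-++⁺ˡ; ∈-++⁺ʳ)
open import Data.List.Relation.Unary.Any using (here)
open import Data.Nat using (ℕ; zero; suc; _+_; _∸_; _≤_; _<_; z≤n; s≤s; _<?_; _≤?_; _≟_; ⌊_/2⌋)
open import Data.Nat.Logarithm using (⌊log₂_⌋; ⌊log₂⌊n/2⌋⌋≡⌊log₂n⌋∸1; ⌊log₂⌋-mono-≤)
open import Data.Nat.Properties
open import Data.Product using (Σ; ∃-syntax; _×_; _,_; proj₁; proj₂; swap)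
open import Data.Sum using (_⊎_; inj₁; inj₂; [_,_]′)
open import Data.Unit using (tt)
open import Function using (_∘_)
open import Function.Bundles using (_⇔_; Equivalence)
open import Relation.Binary using (tri<; tri≈; tri>)
open import Relation.Binary.PropositionalEquality
open import Relation.Nullary using (¬_; Dec; yes; no)
open import Relation.Nullary.Decidable using (isYes; toWitness; fromWitness)

fromBit : Bool → ℕ
fromBit false = 0
fromBit true  = 1

fromBit-injective : ∀ {a b} → fromBit a ≡ fromBit b → a ≡ b
fromBit-injective {false} {false} _ = refl
fromBit-injective {false} {true}  ()
fromBit-injective {true}  {false} ()
fromBit-injective {true}  {true}  _ = refl

⌊m+m+bit/2⌋≡m : ∀ m b → ⌊ m + m + fromBit b /2⌋ ≡ m
⌊m+m+bit/2⌋≡m zero    false = refl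
⌊m+m+bit/2⌋≡m zero    true  = refl
⌊m+m+bit/2⌋≡m (suc m) b rewrite +-suc m m = cong suc (⌊m+m+bit/2⌋≡m m b)

-- The nodes of the infinite binary tree are numbered 1, 2, 3, … so that m has
-- children 2m and 2m+1; node c k is reached from the root by the turns c 0, …, c (k-1).
node : (ℕ → Bool) → ℕ → ℕ
node c zero    = 1
node c (suc k) = node c k + node c k + fromBit (c k)

node-positive : ∀ c k → 1 ≤ node c k
node-positive c zero    = s≤s z≤n
node-positive c (suc k) = ≤-trans (node-positive c k) (≤-trans (m≤m+n _ _) (m≤m+n _ _))

⌊log₂node⌋≡depth : ∀ c k → ⌊log₂ node c k ⌋ ≡ k
⌊log₂node⌋≡depth c zero    = refl
⌊log₂node⌋≡depth c (suc k) = begin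
  ⌊log₂ n ⌋              ≡⟨ sym (m∸n+n≡m 1≤⌊log₂n⌋) ⟩
  ⌊log₂ n ⌋ ∸ 1 + 1      ≡⟨ cong (_+ 1) (sym (⌊log₂⌊n/2⌋⌋≡⌊log₂n⌋∸1 n)) ⟩
  ⌊log₂ ⌊ n /2⌋ ⌋ + 1    ≡⟨ cong (λ p → ⌊log₂ p ⌋ + 1) (⌊m+m+bit/2⌋≡m m (c k)) ⟩
  ⌊log₂ m ⌋ + 1          ≡⟨ cong (_+ 1) (⌊log₂node⌋≡depth c k) ⟩
  k + 1                  ≡⟨ +-comm k 1 ⟩
  suc k                  ∎
  where
  open ≡-Reasoning
  m = node c k
  n = node c (suc k)
  1≤⌊log₂n⌋ : 1 ≤ ⌊log₂ n ⌋
  1≤⌊log₂n⌋ = ⌊log₂⌋-mono-≤ {2} (≤-trans (+-mono-≤ (node-positive c k) (node-positive c k)) (m≤m+n _ _))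

node-depth-injective : ∀ c d {k j} → node c k ≡ node d j → k ≡ j
node-depth-injective c d {k} {j} e =
  trans (sym (⌊log₂node⌋≡depth c k)) (trans (cong ⌊log₂_⌋ e) (⌊log₂node⌋≡depth d j))

node-suc-injective : ∀ a b k → node a (suc k) ≡ node b (suc k) → node a k ≡ node b k × a k ≡ b k
node-suc-injective a b k e = parents , fromBit-injective (+-cancelˡ-≡ (node b k + node b k) _ _ bits)
  where
  parents : node a k ≡ node b k
  parents = trans (sym (⌊m+m+bit/2⌋≡m _ (a k))) (trans (cong ⌊_/2⌋ e) (⌊m+m+bit/2⌋≡m _ (b k)))
  bits : node b k + node b k + fromBit (a k) ≡ node b k + node b k + fromBit (b k)
  bits = trans (cong (λ p → p + p + fromBit (a k)) (sym parents)) e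

node-injective : ∀ a b k → node a k ≡ node b k → ∀ {n} → n < k → a n ≡ b n
node-injective a b (suc k) e n<1+k with node-suc-injective a b k e | m<1+n⇒m<n∨m≡n n<1+k
... | parents , _ | inj₁ n<k  = node-injective a b k parents n<k
... | _ , bits    | inj₂ refl = bits

-- Course-of-values recursion: step s receives the values at j < s as prefix s
-- (its values at j ≥ s are junk).
module CourseOfValues (step : ℕ → (ℕ → ℕ) → ℕ) where

  prefix : ℕ → ℕ → ℕ
  prefix zero    _ = 0
  prefix (suc s) j with j <? s
  ... | yes _ = prefix s j
  ... | no  _ = step s (prefix s)

  sequence : ℕ → ℕ
  sequence s = step s (prefix s)

  prefix-sequence : ∀ {s j} → j < s → prefix s j ≡ sequence j
  prefix-sequence {suc s} {j} j<1+s with j <? s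
  ... | yes j<s = prefix-sequence j<s
  ... | no  j≮s with m<1+n⇒m<n∨m≡n j<1+s
  ...   | inj₁ j<s  = ⊥-elim (j≮s j<s)
  ...   | inj₂ refl = refl

data Role : Set where
  tree switch : ℕ → Role

tree-injective : ∀ {i j} → tree i ≡ tree j → i ≡ j
tree-injective refl = refl

-- Even indices 2i carry the role tree i, odd indices 2n+1 the role switch n.
role : ℕ → Role
role zero          = tree zero
role (suc zero)    = switch zero
role (suc (suc s)) with role s
... | tree i   = tree (suc i)
... | switch n = switch (suc n)

treeIndex : ℕ → ℕ
treeIndex zero    = zero
treeIndex (suc i) = suc (suc (treeIndex i))

switchIndex : ℕ → ℕ
switchIndex n = suc (treeIndex n)

role-treeIndex : ∀ i → role (treeIndex i) ≡ tree i
role-treeIndex zero = refl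
role-treeIndex (suc i) rewrite role-treeIndex i = refl

role-switchIndex : ∀ n → role (switchIndex n) ≡ switch n
role-switchIndex zero = refl
role-switchIndex (suc n) rewrite role-switchIndex n = refl

treeIndex-injective : ∀ {i j} → treeIndex i ≡ treeIndex j → i ≡ j
treeIndex-injective {i} {j} e =
  tree-injective (trans (sym (role-treeIndex i)) (trans (cong role e) (role-treeIndex j)))

module UniversalDigraphProperties (G : UniversalDigraph) where
  open UniversalDigraph G
  open EndMonoid G

  Prescribed : ℕ → ℕ → Bool × Bool → Set
  Prescribed v a (out , in′) = (E v a ⇔ T out) × (E a v ⇔ T in′)

  Realises : ℕ → List ℕ → (ℕ → Bool × Bool) → Set
  Realises v A t = v ∉ A × (∀ a → a ∈ A → Prescribed v a (t a))

  adjacent⇒≢ : ∀ {u w} → E u w → u ≢ w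
  adjacent⇒≢ e refl = irrefl _ e

  commonNeighbour : (A : List ℕ) → ∃[ v ] (∀ {a} → a ∈ A → E v a × E a v)
  commonNeighbour A with extension A (λ _ → true , true)
  ... | v , _ , realised = v , λ {a} a∈A →
        Equivalence.from (proj₁ (realised a a∈A)) tt , Equivalence.from (proj₂ (realised a a∈A)) tt

  -- If f x ≤ n then x is adjacent to g (f x), so f x is adjacent to f (g (f x)) = f x.
  regular⇒unbounded : ∀ f → Regular f → ∀ n → ∃[ x ] n < fun f x
  regular⇒unbounded f (g , fgf≈f) n with commonNeighbour (map (fun g) (upTo (suc n)))
  ... | x , adjacent with fun f x ≤? n
  ...   | no  fx≰n = x , ≰⇒> fx≰n
  ...   | yes fx≤n = ⊥-elim (irrefl _ (subst (E (fun f x)) (fgf≈f x) (hom f x→gfx)))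
    where
    x→gfx : E x (fun g (fun f x))
    x→gfx = proj₁ (adjacent (∈-map⁺ (fun g) (∈-upTo⁺ (s≤s fx≤n))))

  -- The spine S embeds the graph on ℕ with edges s → t for T (Γ s t) into G, and
  -- a vertex y off the spine is adjacent to S s only if s ≤ y.
  module Spine (Γ : ℕ → ℕ → Bool) where

    prescription : ℕ → (ℕ → ℕ) → ℕ → Bool × Bool
    prescription s P x with anyUpTo? (λ j → P j ≟ x) s
    ... | yes (j , _) = Γ s j , Γ j s
    ... | no  _       = false , false

    horizon : ℕ → (ℕ → ℕ) → List ℕ
    horizon zero    _ = []
    horizon (suc s) P = upTo (suc (P s))

    open CourseOfValues (λ s P → proj₁ (extension (horizon s P) (prescription s P))) public
      renaming (sequence to S; prefix to stage; prefix-sequence to stage-S)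

    S-realises : ∀ s → Realises (S s) (horizon s (stage s)) (prescription s (stage s))
    S-realises s = proj₂ (extension (horizon s (stage s)) (prescription s (stage s)))

    OffSpine : ℕ → Set
    OffSpine y = ¬ (∃[ s ] S s ≡ y)

    ≤S⇒∈horizon : ∀ {s y} → y ≤ S s → y ∈ horizon (suc s) (stage (suc s))
    ≤S⇒∈horizon {s} y≤Ss rewrite stage-S (n<1+n s) = ∈-upTo⁺ (s≤s y≤Ss)

    S-<-suc : ∀ s → S s < S (suc s)
    S-<-suc s with S (suc s) ≤? S s
    ... | yes le  = ⊥-elim (proj₁ (S-realises (suc s)) (≤S⇒∈horizon le))
    ... | no  nle = ≰⇒> nle

    S-strictMono : ∀ {s t} → s < t → S s < S t
    S-strictMono {s} {suc t} s<1+t with m<1+n⇒m<n∨m≡n s<1+t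
    ... | inj₁ s<t  = <-trans (S-strictMono s<t) (S-<-suc t)
    ... | inj₂ refl = S-<-suc t

    S-injective : ∀ {s t} → S s ≡ S t → s ≡ t
    S-injective {s} {t} e with <-cmp s t
    ... | tri< s<t _ _ = ⊥-elim (<⇒≢ (S-strictMono s<t) e)
    ... | tri≈ _ s≡t _ = s≡t
    ... | tri> _ _ t<s = ⊥-elim (<⇒≢ (S-strictMono t<s) (sym e))

    n≤S : ∀ s → s ≤ S s
    n≤S zero    = z≤n
    n≤S (suc s) = ≤-<-trans (n≤S s) (S-<-suc s)

    onSpine? : ∀ y → Dec (∃[ s ] S s ≡ y)
    onSpine? y with anyUpTo? (λ s → S s ≟ y) (suc y)
    ... | yes (s , _ , e) = yes (s , e)
    ... | no  none        = no λ { (s , e) → none (s , s≤s (subst (s ≤_) e (n≤S s)) , e) }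

    spine-or-off : ∀ y → (∃[ s ] S s ≡ y) ⊎ OffSpine y
    spine-or-off y with onSpine? y
    ... | yes on  = inj₁ on
    ... | no  off = inj₂ off

    earlier∈horizon : ∀ {s t} → s < t → S s ∈ horizon t (stage t)
    earlier∈horizon {s} {suc t} s<1+t with m<1+n⇒m<n∨m≡n s<1+t
    ... | inj₁ s<t  = ≤S⇒∈horizon (<⇒≤ (S-strictMono s<t))
    ... | inj₂ refl = ≤S⇒∈horizon ≤-refl

    prescription-S : ∀ {s t} → s < t → prescription t (stage t) (S s) ≡ (Γ t s , Γ s t)
    prescription-S {s} {t} s<t with anyUpTo? (λ j → stage t j ≟ S s) t
    ... | yes (j , j<t , e) = cong (λ i → Γ t i , Γ i t) (S-injective (trans (sym (stage-S j<t)) e))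
    ... | no  none          = ⊥-elim (none (s , s<t , stage-S s<t))

    prescription-off : ∀ {t y} → OffSpine y → prescription t (stage t) y ≡ (false , false)
    prescription-off {t} {y} off with anyUpTo? (λ j → stage t j ≟ y) t
    ... | yes (j , j<t , e) = ⊥-elim (off (j , trans (sym (stage-S j<t)) e))
    ... | no  _             = refl

    S-edge< : ∀ {s t} → s < t → Prescribed (S t) (S s) (Γ t s , Γ s t)
    S-edge< {s} {t} s<t =
      subst (Prescribed (S t) (S s)) (prescription-S s<t) (proj₂ (S-realises t) (S s) (earlier∈horizon s<t))

    S-edge : ∀ {s t} → s ≢ t → E (S s) (S t) ⇔ T (Γ s t)
    S-edge {s} {t} s≢t with <-cmp s t
    ... | tri< s<t _ _ = proj₂ (S-edge< s<t)
    ... | tri≈ _ s≡t _ = ⊥-elim (s≢t s≡t)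
    ... | tri> _ _ t<s = proj₁ (S-edge< t<s)

    -- Off-spine vertices up to S (s - 1) were told not to be adjacent to S s.
    S-isolated : ∀ {s y} → OffSpine y → E (S s) y ⊎ E y (S s) → s ≤ y
    S-isolated {zero}  _ _ = z≤n
    S-isolated {suc s} {y} off adjacent with y ≤? S s
    ... | no  y≰Ss = ≤-<-trans (n≤S s) (≰⇒> y≰Ss)
    ... | yes y≤Ss = ⊥-elim ([ Equivalence.to out , Equivalence.to in′ ]′ adjacent)
      where
      prescribed : Prescribed (S (suc s)) y (false , false)
      prescribed = subst (Prescribed (S (suc s)) y) (prescription-off {suc s} off)
                         (proj₂ (S-realises (suc s)) y (≤S⇒∈horizon y≤Ss))
      out = proj₁ prescribed
      in′ = proj₂ prescribed

    module Extend (φ : ℕ → ℕ) (φ-hom : ∀ {s t} → T (Γ s t) → E (φ s) (φ t)) where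

      neighbourhood : ℕ → (ℕ → ℕ) → List ℕ
      neighbourhood w P = map φ (upTo (suc w)) ++ map P (upTo w)

      -- An off-spine vertex goes to a common neighbour of every possible image of its neighbours.
      extendStep : ℕ → (ℕ → ℕ) → ℕ
      extendStep w P with onSpine? w
      ... | yes (s , _) = φ s
      ... | no  _       = proj₁ (commonNeighbour (neighbourhood w P))

      open CourseOfValues extendStep
        renaming (sequence to v; prefix to vStage; prefix-sequence to vStage-v)

      v-S : ∀ s → v (S s) ≡ φ s
      v-S s with onSpine? (S s)
      ... | yes (t , e) = cong φ (S-injective e)
      ... | no  off     = ⊥-elim (off (s , refl))

      v-off : ∀ {w} → OffSpine w → ∀ {u} → u ∈ neighbourhood w (vStage w) → E (v w) u × E u (v w)
      v-off {w} off with onSpine? w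
      ... | yes on = ⊥-elim (off on)
      ... | no  _  = proj₂ (commonNeighbour (neighbourhood w (vStage w)))

      earlier∈neighbourhood : ∀ {x w} → x < w → v x ∈ neighbourhood w (vStage w)
      earlier∈neighbourhood {x} {w} x<w = ∈-++⁺ʳ (map φ (upTo (suc w)))
        (subst (_∈ map (vStage w) (upTo w)) (vStage-v x<w) (∈-map⁺ (vStage w) (∈-upTo⁺ x<w)))

      spine∈neighbourhood : ∀ {s w} → s ≤ w → v (S s) ∈ neighbourhood w (vStage w)
      spine∈neighbourhood {s} s≤w rewrite v-S s = ∈-++⁺ˡ (∈-map⁺ φ (∈-upTo⁺ (s≤s s≤w)))

      adjacent-off-spine : ∀ {u w} → OffSpine w → E u w ⊎ E w u → E (v u) (v w) × E (v w) (v u)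
      adjacent-off-spine {u} {w} off-w adjacent with <-cmp u w
      ... | tri< u<w _ _ = swap (v-off off-w (earlier∈neighbourhood u<w))
      ... | tri≈ _ refl _ = ⊥-elim ([ irrefl u , irrefl u ]′ adjacent)
      ... | tri> _ _ w<u with spine-or-off u
      ...   | inj₁ (s , refl) = swap (v-off off-w (spine∈neighbourhood (S-isolated off-w adjacent)))
      ...   | inj₂ off-u      = v-off off-u (earlier∈neighbourhood w<u)

      v-hom : ∀ {x y} → E x y → E (v x) (v y)
      v-hom {x} {y} e with spine-or-off x | spine-or-off y
      ... | _               | inj₂ off-y      = proj₁ (adjacent-off-spine off-y (inj₁ e))
      ... | inj₂ off-x      | inj₁ _          = proj₂ (adjacent-off-spine off-x (inj₂ e))
      ... | inj₁ (s , refl) | inj₁ (t , refl) =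
        subst₂ E (sym (v-S s)) (sym (v-S t)) (φ-hom (Equivalence.to (S-edge (adjacent⇒≢ e ∘ cong S)) e))

      extend : End
      extend = endo v v-hom

module Green (G : UniversalDigraph) where
  open EndMonoid G

  identity : End
  identity = endo (λ x → x) (λ e → e)

  L-refl : ∀ {f} → f L f
  L-refl = (identity , λ _ → refl) , (identity , λ _ → refl)

  R-refl : ∀ {f} → f R f
  R-refl = (identity , λ _ → refl) , (identity , λ _ → refl)

  L⇒D : ∀ {f g} → f L g → f D g
  L⇒D {g = g} f∼g = g , f∼g , R-refl {g}

  R⇒D : ∀ {f g} → f R g → f D g
  R⇒D {f} f∼g = f , L-refl {f} , f∼g

  retraction-R : ∀ {r s} → (r · s) ≈ identity → ∀ f → (f · r) R f
  retraction-R {r} {s} rs≈1 f = (s , λ x → cong (fun f) (rs≈1 x)) , (r , λ _ → refl)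

  section-L : ∀ {r s} → (r · s) ≈ identity → ∀ f → (s · f) L f
  section-L {r} {s} rs≈1 f = (r , λ x → rs≈1 (fun f x)) , (s , λ _ → refl)

module Retractions (G : UniversalDigraph) where
  open UniversalDigraph G
  open EndMonoid G
  open UniversalDigraphProperties G
  open Green G

  roleEdge : Role → Role → Bool
  roleEdge (tree i) (tree j) = isYes (E? ⌊log₂ i ⌋ ⌊log₂ j ⌋)
  roleEdge _        _        = false

  Γ : ℕ → ℕ → Bool
  Γ s t = roleEdge (role s) (role t)

  open Spine Γ

  partner : ℕ
  partner = proj₁ (commonNeighbour (0 ∷ []))

  0→partner : E 0 partner
  0→partner = proj₂ (proj₂ (commonNeighbour (0 ∷ [])) (here refl))

  switchValue : Bool → ℕ
  switchValue true  = 0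
  switchValue false = partner

  retractionOn : (ℕ → Bool) → Role → ℕ
  retractionOn a (tree i)   = ⌊log₂ i ⌋
  retractionOn a (switch n) = switchValue (a n)

  retractionOn-hom : ∀ a ρ σ → T (roleEdge ρ σ) → E (retractionOn a ρ) (retractionOn a σ)
  retractionOn-hom a (tree i)   (tree j)   t = toWitness t
  retractionOn-hom a (tree _)   (switch _) ()
  retractionOn-hom a (switch _) _          ()

  module RetractionOn (a : ℕ → Bool) =
    Extend (retractionOn a ∘ role) (λ {s} {t} → retractionOn-hom a (role s) (role t))

  V : (ℕ → Bool) → End
  V = RetractionOn.extend

  treeVertex : ℕ → ℕ
  treeVertex i = S (treeIndex i)

  switchVertex : ℕ → ℕ
  switchVertex n = S (switchIndex n)

  treeVertex-edge : ∀ {i j} → i ≢ j → E ⌊log₂ i ⌋ ⌊log₂ j ⌋ → E (treeVertex i) (treeVertex j)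
  treeVertex-edge {i} {j} i≢j e = Equivalence.from (S-edge (i≢j ∘ treeIndex-injective))
    (subst T (sym (cong₂ roleEdge (role-treeIndex i) (role-treeIndex j))) (fromWitness e))

  Z-hom : ∀ c {k j} → E k j → E (treeVertex (node c k)) (treeVertex (node c j))
  Z-hom c {k} {j} e = treeVertex-edge (adjacent⇒≢ e ∘ node-depth-injective c c)
    (subst₂ E (sym (⌊log₂node⌋≡depth c k)) (sym (⌊log₂node⌋≡depth c j)) e)

  Z : (ℕ → Bool) → End
  Z c = endo (treeVertex ∘ node c) (Z-hom c)

  V-treeVertex : ∀ a i → fun (V a) (treeVertex i) ≡ ⌊log₂ i ⌋
  V-treeVertex a i = trans (RetractionOn.v-S a (treeIndex i)) (cong (retractionOn a) (role-treeIndex i))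

  V-switchVertex : ∀ a n → fun (V a) (switchVertex n) ≡ switchValue (a n)
  V-switchVertex a n = trans (RetractionOn.v-S a (switchIndex n)) (cong (retractionOn a) (role-switchIndex n))

  V∘Z≈identity : ∀ a c → (V a · Z c) ≈ identity
  V∘Z≈identity a c k = trans (V-treeVertex a (node c k)) (⌊log₂node⌋≡depth c k)

  ·V-D : ∀ f a → (f · V a) D f
  ·V-D f a = R⇒D {f · V a} {f} (retraction-R {V a} {Z a} (V∘Z≈identity a a) f)

  Z·-D : ∀ f a → (Z a · f) D f
  Z·-D f a = L⇒D {Z a · f} {f} (section-L {V a} {Z a} (V∘Z≈identity a a) f)

  Z-agree⇒prefix : ∀ {a b k} → fun (Z a) k ≡ fun (Z b) k → ∀ {n} → n < k → a n ≡ b n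
  Z-agree⇒prefix {a} {b} {k} e = node-injective a b k (treeIndex-injective (S-injective e))

  -- V a identifies the root Z a 0 with switchVertex n, whereas V b sends them
  -- to the adjacent vertices 0 and partner, which f cannot identify.
  noLeftFactor : ∀ f a b n → a n ≡ true → b n ≡ false → ¬ (∃[ h ] ((h · (f · V a)) ≈ (f · V b)))
  noLeftFactor f a b n an bn (h , h∘fVa≈fVb) = adjacent⇒≢ (hom f 0→partner) (begin
    fun f 0                                    ≡⟨ cong (fun f) (sym (V∘Z≈identity b a 0)) ⟩
    fun f (fun (V b) root)                     ≡⟨ sym (h∘fVa≈fVb root) ⟩
    fun h (fun f (fun (V a) root))             ≡⟨ cong (fun h ∘ fun f) (trans (V∘Z≈identity a a 0) (sym Va-switch)) ⟩
    fun h (fun f (fun (V a) (switchVertex n))) ≡⟨ h∘fVa≈fVb (switchVertex n) ⟩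
    fun f (fun (V b) (switchVertex n))         ≡⟨ cong (fun f) (trans (V-switchVertex b n) (cong switchValue bn)) ⟩
    fun f partner                              ∎)
    where
    open ≡-Reasoning
    root = fun (Z a) 0
    Va-switch : fun (V a) (switchVertex n) ≡ 0
    Va-switch = trans (V-switchVertex a n) (cong switchValue an)

  ·V-L-separates : ∀ f a b → (f · V a) L (f · V b) → ∀ n → a n ≡ b n
  ·V-L-separates f a b (h∘fVa≈fVb , k∘fVb≈fVa) n with a n in an | b n in bn
  ... | true  | true  = refl
  ... | false | false = refl
  ... | true  | false = ⊥-elim (noLeftFactor f a b n an bn h∘fVa≈fVb)
  ... | false | true  = ⊥-elim (noLeftFactor f b a n bn an k∘fVb≈fVa)

  -- Applying V a to Z a (f (h x)) = Z b (f x) gives f (h x) = f x, so Z a and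
  -- Z b agree at f x, which can be chosen above n.
  Z·-R-separates : ∀ f → Regular f → ∀ a b → (Z a · f) R (Z b · f) → ∀ n → a n ≡ b n
  Z·-R-separates f reg a b ((h , Zafh≈Zbf) , _) n =
    Z-agree⇒prefix {a} {b} (Z-agree x) n<fx
    where
    x = proj₁ (regular⇒unbounded f reg n)
    n<fx = proj₂ (regular⇒unbounded f reg n)
    fh≈f : ∀ y → fun f (fun h y) ≡ fun f y
    fh≈f y = trans (sym (V∘Z≈identity a a (fun f (fun h y))))
                   (trans (cong (fun (V a)) (Zafh≈Zbf y)) (V∘Z≈identity a b (fun f y)))
    Z-agree : ∀ y → fun (Z a) (fun f y) ≡ fun (Z b) (fun f y)
    Z-agree y = trans (cong (fun (Z a)) (sym (fh≈f y))) (Zafh≈Zbf y)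

theorem4p6 : (G : UniversalDigraph) → let open EndMonoid G in
    (f : End) → Regular f →
    (Σ ((ℕ → Bool) → End) λ Φ → ((∀ a → Φ a D f) × (∀ (a b : ℕ → Bool) → Φ a L Φ b → ∀ n → a n ≡ b n)))
    × (Σ ((ℕ → Bool) → End) λ Ψ → ((∀ a → Ψ a D f) × (∀ (a b : ℕ → Bool) → Ψ a R Ψ b → ∀ n → a n ≡ b n)))
theorem4p6 G f reg =
    ((λ a → f · V a) , ·V-D f , ·V-L-separates f)
  , ((λ a → Z a · f) , Z·-D f , Z·-R-separates f reg)
  where
  open EndMonoid G
  open Retractions G
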